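{- Let $k \ge 3$ be an odd integer. Every $k$-quasi-transitive digraph $D$ has a $(k+2)$-kernel, i.e., a set $K \subseteq V(D)$ such that $d(u,v) \ge k+2$ for all distinct $u,v \in K$, and for every $u \in V(D) \setminus K$ there exists $v \in K$ with $d(u,v) \le k+1$.
   Context: All digraphs are finite, without loops and without multiple arcs in the same direction; paths are directed. For $u,v \in V(D)$, $d(u,v)$ is the length of a shortest directed $uv$-path ($\infty$ if none). $D$ is $k$-quasi-transitive if for every directed path $(v_0, \dots, v_k)$ of length $k$, $(v_0,v_k) \in A(D)$ or $(v_k,v_0) \in A(D)$. A set $S$ is $m$-independent if $d(u,v)\ge m$ for distinct $u,v\in S$, and $l$-absorbent if every vertex outside $S$ reaches some vertex of $S$ at distance at most $l$; an $m$-kernel is an $m$-independent, $(m-1)$-absorbent set. -}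

module Defs where

open import Data.Nat using (ℕ; zero; suc; _+_; _≤_; _<_)
open import Data.Fin using (Fin)
open import Data.Fin.Subset using (Subset; _∈_; _∉_)
open import Data.Bool using (Bool; true; false; T)
open import Data.Vec using (Vec; []; _∷_; head; last; lookup)
open import Data.Vec.Relation.Unary.Unique.Propositional using (Unique)
open import Data.Product using (Σ; ∃; ∃-syntax; _×_; _,_)
open import Data.Sum using (_⊎_)
open import Data.Empty using (⊥)
open import Relation.Nullary using (¬_)
open import Relation.Binary.PropositionalEquality using (_≡_)

-- A finite digraph on vertex set Fin n: an arc relation given by a Boolean
-- adjacency function, with no loops. (At most one arc per ordered pair is
-- automatic for an adjacency function.)
record Digraph (n : ℕ) : Set where
  field
    arc      : Fin n → Fin n → Bool
    loopless : ∀ v → arc v v ≡ false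

open Digraph public

Arc : ∀ {n} → Digraph n → Fin n → Fin n → Set
Arc D u v = T (arc D u v)

Consecutive : ∀ {n ℓ} → Digraph n → Vec (Fin n) (suc ℓ) → Set
Consecutive D (x ∷ []) = Data.Unit.⊤
  where import Data.Unit
Consecutive D (x ∷ y ∷ xs) = Arc D x y × Consecutive D (y ∷ xs)

record Path {n : ℕ} (D : Digraph n) (ℓ : ℕ) : Set where
  field
    vertices : Vec (Fin n) (suc ℓ)
    arcs     : Consecutive D vertices
    distinct : Unique vertices

open Path public

PathFromTo : ∀ {n} → Digraph n → ℕ → Fin n → Fin n → Set
PathFromTo D ℓ u v = Σ (Path D ℓ) λ p → head (vertices p) ≡ u × last (vertices p) ≡ v

DistLe : ∀ {n} → Digraph n → Fin n → Fin n → ℕ → Set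
DistLe D u v l = ∃[ ℓ ] (ℓ ≤ l × PathFromTo D ℓ u v)

-- d(u,v) ≥ m : there is no directed uv-path of length < m (d = ∞ allowed)
DistGe : ∀ {n} → Digraph n → Fin n → Fin n → ℕ → Set
DistGe D u v m = ∀ ℓ → ℓ < m → ¬ PathFromTo D ℓ u v

QuasiTransitive : ∀ {n} → ℕ → Digraph n → Set
QuasiTransitive k D = (p : Path D k) →
  Arc D (head (vertices p)) (last (vertices p)) ⊎ Arc D (last (vertices p)) (head (vertices p))

Independent : ∀ {n} → Digraph n → ℕ → Subset n → Set
Independent D m S = ∀ u v → u ∈ S → v ∈ S → ¬ u ≡ v → DistGe D u v m

Absorbent : ∀ {n} → Digraph n → ℕ → Subset n → Set
Absorbent D l S = ∀ u → u ∉ S → ∃[ v ] (v ∈ S × DistLe D u v l)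

IsKernel : ∀ {n} → Digraph n → ℕ → Subset n → Set
IsKernel D m S = Independent D m S × Absorbent D (m Data.Nat.∸ 1) S

module Submission where

-- Along a shortest walk v₀ … v_L in a k-quasi-transitive digraph (k ≥ 2), applying quasi-transitivity
-- to subpaths, and to detours that jump back and then run forward, can only produce backward arcs,
-- because a forward chord would shorten the walk: v_j → v_i whenever j − i = k + 2t, and
-- v_j → v_(j−3) whenever j ≥ k + 2. So if y reaches x only by walks longer than k + 1, then x
-- reaches y in one or two steps, and every vertex reaching x within k + 1 steps reaches y within
-- k + 1 steps. Starting in a terminal strong component and moving to such a y strictly shrinks the
-- set of vertices that are far from the current vertex; this ends at a terminal vertex reached within
-- k + 1 steps by everything that reaches it. Among those, the vertices of least index in their reach
-- form the kernel: two of them joined by a path lie in one terminal component, so they coincide.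

open import Defs
open import Algebra.Properties.CommutativeSemigroup using (x∙yz≈y∙xz)
open import Data.Empty using (⊥; ⊥-elim)
open import Data.Fin using (Fin; toℕ)
open import Data.Fin.Properties using (any?; all?; pigeonhole; toℕ-injective; toℕ≤pred[n])
  renaming (_≟_ to _≟ᶠ_)
open import Data.Fin.Subset using (Subset; _∈_; _⊂_)
open import Data.Fin.Subset.Induction using (⊂-wellFounded)
open import Data.Nat using (ℕ; zero; suc; _+_; _*_; _∸_; _≤_; _<_; z≤n; s≤s; z<s; s<s; s≤s⁻¹; s<s⁻¹)
open import Data.Nat.Induction using (<-rec)
open import Data.Nat.Properties
open import Data.Nat.Tactic.RingSolver using (solve-∀)
open import Data.Product using (∃-syntax; _×_; _,_; proj₁; proj₂)
open import Data.Sum using (_⊎_; inj₁; inj₂; [_,_]′)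
open import Data.Unit using (⊤; tt)
open import Data.Vec using (Vec; []; _∷_; head; last; tabulate)
open import Data.Vec.Properties using (lookup∘tabulate; []=⇒lookup; lookup⇒[]=)
open import Data.Vec.Relation.Unary.Unique.Propositional.Properties using (tabulate⁺)
open import Function using (_∘_)
open import Induction.WellFounded using (Acc; acc)
open import Level using (0ℓ)
open import Relation.Binary.Definitions using (tri<; tri≈; tri>)
open import Relation.Binary.PropositionalEquality
open import Relation.Nullary using (¬_; Dec; yes; no; does)
open import Relation.Nullary.Decidable using (_×-dec_; _→-dec_; ¬?; T?; map′; decidable-stable; dec-true)
open import Relation.Unary using (Pred; Decidable)

leastWitness : {P : Pred ℕ 0ℓ} → Decidable P → ∀ {m} → P m → ∃[ L ] (P L × (∀ {ℓ} → ℓ < L → ¬ P ℓ))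
leastWitness {P} P? = <-rec Goal search _
  where
  Goal : ℕ → Set
  Goal m = P m → ∃[ L ] (P L × (∀ {ℓ} → ℓ < L → ¬ P ℓ))
  search : ∀ m → (∀ {ℓ} → ℓ < m → Goal ℓ) → Goal m
  search m smaller Pm with anyUpTo? P? m
  ... | yes (ℓ , ℓ<m , Pℓ) = smaller ℓ<m Pℓ
  ... | no none = m , Pm , λ ℓ<m Pℓ → none (_ , ℓ<m , Pℓ)

parity : ∀ d → ∃[ t ] (d ≡ 2 * t ⊎ d ≡ 1 + 2 * t)
parity zero = 0 , inj₁ refl
parity (suc d) with parity d
... | t , inj₁ refl = t , inj₂ refl
... | t , inj₂ refl = suc t , inj₁ (cong suc (sym (+-suc t (t + 0))))

InjectiveUpTo : {A : Set} → (ℕ → A) → ℕ → Set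
InjectiveUpTo f L = ∀ {i j} → i ≤ L → j ≤ L → f i ≡ f j → i ≡ j

runThen : ℕ → ℕ → ℕ → ℕ → ℕ
runThen c s x i with i ≤? c
... | yes _ = i + s
... | no _ = x

runThen-cases : ∀ c s x i → (i ≤ c × runThen c s x i ≡ i + s) ⊎ (c < i × runThen c s x i ≡ x)
runThen-cases c s x i with i ≤? c
... | yes i≤c = inj₁ (i≤c , refl)
... | no i≰c = inj₂ (≰⇒> i≰c , refl)

select : ∀ {n} {P : Pred (Fin n) 0ℓ} → Decidable P → Subset n
select P? = tabulate (does ∘ P?)

module _ {n} {P : Pred (Fin n) 0ℓ} (P? : Decidable P) where

  ∈-select⁺ : ∀ {x} → P x → x ∈ select P?
  ∈-select⁺ {x} Px = lookup⇒[]= x _ (trans (lookup∘tabulate _ x) (dec-true (P? x) Px))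

  ∈-select⁻ : ∀ {x} → x ∈ select P? → P x
  ∈-select⁻ {x} x∈ with P? x | trans (sym (lookup∘tabulate (does ∘ P?) x)) ([]=⇒lookup x∈)
  ... | yes Px | _ = Px
  ... | no _ | ()

select-⊂ : ∀ {n} {P Q : Pred (Fin n) 0ℓ} (P? : Decidable P) (Q? : Decidable Q) {w} →
           (∀ {x} → P x → Q x) → Q w → ¬ P w → select P? ⊂ select Q?
select-⊂ P? Q? P⇒Q Qw ¬Pw =
  (λ x∈ → ∈-select⁺ Q? (P⇒Q (∈-select⁻ P? x∈))) , _ , ∈-select⁺ Q? Qw , ¬Pw ∘ ∈-select⁻ P?

module _ {A : Set} {R : A → A → Set} (R-refl : ∀ {x} → R x x)
         (R-trans : ∀ {x y z} → R x y → R y z → R x z) {n} (μ : A → Subset n) {I Q : Pred A 0ℓ} where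

  descend : (∀ x → I x → Q x ⊎ ∃[ y ] (R x y × I y × μ y ⊂ μ x)) →
            ∀ x → I x → ∃[ y ] (R x y × Q y)
  descend step x = go x (⊂-wellFounded (μ x))
    where
    go : ∀ x → Acc _⊂_ (μ x) → I x → ∃[ y ] (R x y × Q y)
    go x (acc smaller) Ix with step x Ix
    ... | inj₁ Qx = x , R-refl , Qx
    ... | inj₂ (y , Rxy , Iy , μy⊂μx) with go y (smaller μy⊂μx) Iy
    ...   | z , Ryz , Qz = z , R-trans Rxy Ryz , Qz

-- Walks and geodesics

module _ {n : ℕ} (D : Digraph n) where

  infixr 5 _◅_ _◅◅_

  data Walk : Fin n → Fin n → ℕ → Set where
    ε   : ∀ {u} → Walk u u 0
    _◅_ : ∀ {u w v ℓ} → Arc D u w → Walk w v ℓ → Walk u v (suc ℓ)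

  _◅◅_ : ∀ {u v w a b} → Walk u v a → Walk v w b → Walk u w (a + b)
  ε ◅◅ q = q
  (e ◅ p) ◅◅ q = e ◅ (p ◅◅ q)

  walk? : ∀ u v ℓ → Dec (Walk u v ℓ)
  walk? u v zero = map′ (λ { refl → ε }) (λ { ε → refl }) (u ≟ᶠ v)
  walk? u v (suc ℓ) = map′ (λ (w , e , p) → e ◅ p) (λ { (e ◅ p) → _ , e , p })
                           (any? λ w → T? (arc D u w) ×-dec walk? w v ℓ)

  Within : Fin n → Fin n → ℕ → Set
  Within u v l = ∃[ ℓ ] (ℓ ≤ l × Walk u v ℓ)

  within? : ∀ u v l → Dec (Within u v l)
  within? u v l = map′ (λ (ℓ , ℓ<1+l , p) → ℓ , s≤s⁻¹ ℓ<1+l , p) (λ (ℓ , ℓ≤l , p) → ℓ , s≤s ℓ≤l , p)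
                       (anyUpTo? (walk? u v) (suc l))

  Shortest : Fin n → Fin n → ℕ → Set
  Shortest u v L = Walk u v L × (∀ {ℓ} → ℓ < L → ¬ Walk u v ℓ)

  shortest : ∀ {u v ℓ} → Walk u v ℓ → ∃[ L ] (L ≤ ℓ × Shortest u v L)
  shortest {u} {v} p with leastWitness (walk? u v) p
  ... | L , q , minimal = L , ≮⇒≥ (λ ℓ<L → minimal ℓ<L p) , q , minimal

  shortest⇒¬within : ∀ {u v L l} → Shortest u v L → l < L → ¬ Within u v l
  shortest⇒¬within (_ , minimal) l<L (ℓ , ℓ≤l , p) = minimal (≤-<-trans ℓ≤l l<L) p

  ¬within⇒long : ∀ {u v L l} → Walk u v L → ¬ Within u v l → l < L
  ¬within⇒long {L = L} p far = ≰⇒> (λ L≤l → far (L , L≤l , p))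

  ¬within⇒shortest : ∀ {u v L l} → Walk u v L → ¬ Within u v l → L ≤ suc l → Shortest u v L
  ¬within⇒shortest p far L≤1+l = p , λ ℓ<L q → far (_ , s≤s⁻¹ (≤-trans ℓ<L L≤1+l) , q)

  WalkAlong : (ℕ → Fin n) → ℕ → Set
  WalkAlong r L = ∀ {i} → i < L → Arc D (r i) (r (suc i))

  vertexAt : ∀ {u v ℓ} → Walk u v ℓ → ℕ → Fin n
  vertexAt {u} ε _ = u
  vertexAt {u} (_ ◅ _) zero = u
  vertexAt (_ ◅ p) (suc i) = vertexAt p i

  vertexAt-start : ∀ {u v ℓ} (p : Walk u v ℓ) → vertexAt p 0 ≡ u
  vertexAt-start ε = refl
  vertexAt-start (_ ◅ _) = refl

  vertexAt-end : ∀ {u v ℓ} (p : Walk u v ℓ) → vertexAt p ℓ ≡ v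
  vertexAt-end ε = refl
  vertexAt-end (_ ◅ p) = vertexAt-end p

  vertexAt-◅◅ : ∀ {u v w a b} (p : Walk u v a) (q : Walk v w b) → vertexAt (p ◅◅ q) a ≡ v
  vertexAt-◅◅ ε q = vertexAt-start q
  vertexAt-◅◅ (_ ◅ p) q = vertexAt-◅◅ p q

  vertexAt-along : ∀ {u v ℓ} (p : Walk u v ℓ) → WalkAlong (vertexAt p) ℓ
  vertexAt-along (e ◅ p) {zero} _ = subst (Arc D _) (sym (vertexAt-start p)) e
  vertexAt-along (e ◅ p) {suc i} i<ℓ = vertexAt-along p (s<s⁻¹ i<ℓ)

  walkAlong-prefix : ∀ {r L i} → WalkAlong r L → i ≤ L → Walk (r 0) (r i) i
  walkAlong-prefix {i = zero} along _ = ε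
  walkAlong-prefix {r} {suc L} {suc i} along (s≤s i≤L) =
    along z<s ◅ walkAlong-prefix {r ∘ suc} (λ j<L → along (s<s j<L)) i≤L

  walkAlong-segment : ∀ {r L} i {d} → WalkAlong r L → d + i ≤ L → Walk (r i) (r (d + i)) d
  walkAlong-segment {r} i along d+i≤L =
    walkAlong-prefix {λ j → r (j + i)} (λ j<d → along (<-≤-trans (+-monoˡ-< i j<d) d+i≤L)) ≤-refl

  tabulate-consecutive : ∀ {ℓ} r → WalkAlong r ℓ → Consecutive D (tabulate {n = suc ℓ} (r ∘ toℕ))
  tabulate-consecutive {zero} r _ = tt
  tabulate-consecutive {suc ℓ} r along =
    along z<s , tabulate-consecutive (r ∘ suc) (λ i<ℓ → along (s<s i<ℓ))

  last-tabulate : ∀ {ℓ} (r : ℕ → Fin n) → last (tabulate {n = suc ℓ} (r ∘ toℕ)) ≡ r ℓ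
  last-tabulate {zero} r = refl
  last-tabulate {suc ℓ} r = last-tabulate {ℓ} (r ∘ suc)

  pathAlong : ∀ {ℓ} r → WalkAlong r ℓ → InjectiveUpTo r ℓ → PathFromTo D ℓ (r 0) (r ℓ)
  pathAlong r along injective =
    record { vertices = tabulate (r ∘ toℕ)
           ; arcs     = tabulate-consecutive r along
           ; distinct = tabulate⁺ λ {i} {j} →
                          toℕ-injective ∘ injective (toℕ≤pred[n] i) (toℕ≤pred[n] j) }
    , refl , last-tabulate r

  consecutive⇒walk : ∀ {ℓ} (xs : Vec (Fin n) (suc ℓ)) → Consecutive D xs → Walk (head xs) (last xs) ℓ
  consecutive⇒walk (x ∷ []) _ = ε
  consecutive⇒walk (x ∷ y ∷ xs) (e , arcs) = e ◅ consecutive⇒walk (y ∷ xs) arcs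

  path⇒walk : ∀ {ℓ u v} → PathFromTo D ℓ u v → Walk u v ℓ
  path⇒walk (p , refl , refl) = consecutive⇒walk (vertices p) (arcs p)

  record Geodesic (r : ℕ → Fin n) (L : ℕ) : Set where
    field
      along      : WalkAlong r L
      -- ℓ + i < j is ℓ < j − i without truncated subtraction.
      noShortcut : ∀ {i j ℓ} → j ≤ L → ℓ + i < j → ¬ Walk (r i) (r j) ℓ

  open Geodesic public

  shortest⇒geodesic : ∀ {u v L} (p : Walk u v L) → (∀ {ℓ} → ℓ < L → ¬ Walk u v ℓ) →
                      Geodesic (vertexAt p) L
  shortest⇒geodesic {u} {v} {L} p minimal = record { along = vertexAt-along p ; noShortcut = shortcut }
    where
    r = vertexAt p
    shortcut : ∀ {i j ℓ} → j ≤ L → ℓ + i < j → ¬ Walk (r i) (r j) ℓ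
    shortcut {i} {j} {ℓ} j≤L ℓ+i<j q with m≤n⇒∃[o]m+o≡n j≤L
    ... | e , refl =
      minimal shorter (subst₂ (λ x y → Walk x y _) (vertexAt-start p) (vertexAt-end p) whole)
      where
      suffix : Walk (r j) (r (j + e)) e
      suffix = subst (λ x → Walk (r j) (r x) e) (+-comm e j)
                 (walkAlong-segment j (vertexAt-along p) (≤-reflexive (+-comm e j)))
      whole : Walk (r 0) (r (j + e)) (i + (ℓ + e))
      whole = walkAlong-prefix (vertexAt-along p) (≤-trans (m+n≤o⇒n≤o ℓ (<⇒≤ ℓ+i<j)) j≤L) ◅◅ q ◅◅ suffix
      shorter : i + (ℓ + e) < j + e
      shorter = subst (_< j + e) (+-assoc i ℓ e) (+-monoˡ-< e (subst (_< j) (+-comm ℓ i) ℓ+i<j))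

  module _ {r L} (geo : Geodesic r L) where

    geodesic-injective : InjectiveUpTo r L
    geodesic-injective {i} {j} i≤L j≤L eq with <-cmp i j
    ... | tri< i<j _ _ = ⊥-elim (noShortcut geo j≤L i<j (subst (λ x → Walk (r i) x 0) eq ε))
    ... | tri≈ _ i≡j _ = i≡j
    ... | tri> _ _ j<i = ⊥-elim (noShortcut geo i≤L j<i (subst (λ x → Walk (r j) x 0) (sym eq) ε))

    geodesic-noChord : ∀ {i j} → 2 + i ≤ j → j ≤ L → ¬ Arc D (r i) (r j)
    geodesic-noChord 2+i≤j j≤L e = noShortcut geo j≤L 2+i≤j (e ◅ ε)

    geodesic-length<n : L < n
    geodesic-length<n with L <? n
    ... | yes L<n = L<n
    ... | no L≮n with pigeonhole (≰⇒> L≮n) (r ∘ toℕ)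
    ...   | i , j , i<j , eq = ⊥-elim (<⇒≢ i<j (geodesic-injective (toℕ≤pred[n] i) (toℕ≤pred[n] j) eq))

    geodesic-path : PathFromTo D L (r 0) (r L)
    geodesic-path = pathAlong r (along geo) geodesic-injective

  shortest-geodesic : ∀ {u v L} → Shortest u v L → ∃[ r ] (Geodesic r L × r 0 ≡ u × r L ≡ v)
  shortest-geodesic (p , minimal) =
    vertexAt p , shortest⇒geodesic p minimal , vertexAt-start p , vertexAt-end p

  walk⇒distLe : ∀ {u v ℓ l} → Walk u v ℓ → ℓ ≤ l → DistLe D u v l
  walk⇒distLe p ℓ≤l with shortest p
  ... | L , L≤ℓ , s with shortest-geodesic s
  ...   | r , geo , refl , refl = L , ≤-trans L≤ℓ ℓ≤l , geodesic-path geo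

  Reach : Fin n → Fin n → Set
  Reach u v = ∃[ ℓ ] Walk u v ℓ

  reach? : ∀ u v → Dec (Reach u v)
  reach? u v = map′ (λ (ℓ , _ , p) → ℓ , p) short (within? u v n)
    where
    short : Reach u v → Within u v n
    short (_ , p) with shortest p
    ... | L , _ , s with shortest-geodesic s
    ...   | r , geo , refl , refl = L , <⇒≤ (geodesic-length<n geo) , proj₁ s

  reach-refl : ∀ {u} → Reach u u
  reach-refl = 0 , ε

  reach-trans : ∀ {u v w} → Reach u v → Reach v w → Reach u w
  reach-trans (_ , p) (_ , q) = _ , p ◅◅ q

  quasiTransitive-along : ∀ {k r} → QuasiTransitive k D → WalkAlong r k → InjectiveUpTo r k →
                          Arc D (r 0) (r k) ⊎ Arc D (r k) (r 0)
  quasiTransitive-along {r = r} qt along injective with pathAlong r along injective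
  ... | path , start , end = subst₂ (λ x y → Arc D x y ⊎ Arc D y x) start end (qt path)

  -- Back arcs along geodesics

  module _ {c} (qt : QuasiTransitive (2 + c) D) where

    private
      k : ℕ
      k = 2 + c

    module _ {r L} (geo : Geodesic r L) where

      geodesic-quasiTransitive : (h : ℕ → ℕ) → (∀ {i} → i ≤ k → h i ≤ L) → InjectiveUpTo h k →
                                 WalkAlong (r ∘ h) k →
                                 Arc D (r (h 0)) (r (h k)) ⊎ Arc D (r (h k)) (r (h 0))
      geodesic-quasiTransitive h bounded injective along′ =
        quasiTransitive-along qt along′ λ i≤k j≤k eq →
          injective i≤k j≤k (geodesic-injective geo (bounded i≤k) (bounded j≤k) eq)

      backArc : ∀ a → k + a ≤ L → Arc D (r (k + a)) (r a)
      backArc a k+a≤L with geodesic-quasiTransitive (_+ a) (λ i≤k → ≤-trans (+-monoˡ-≤ a i≤k) k+a≤L)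
                             (λ _ _ → +-cancelʳ-≡ a _ _)
                             (λ i<k → along geo (<-≤-trans (+-monoˡ-< a i<k) k+a≤L))
      ... | inj₁ forward = ⊥-elim (geodesic-noChord geo (s≤s (s≤s (m≤n+m a c))) k+a≤L forward)
      ... | inj₂ back = back

      -- Quasi-transitivity on the path p, s, 1 + s, …, c + s, x, of length k.
      detour : ∀ {p s x} → p ≤ L → c + s < p → 2 + x ≤ p → x < s ⊎ c + s < x →
               Arc D (r p) (r s) → Arc D (r (c + s)) (r x) → Arc D (r p) (r x)
      detour {p} {s} {x} p≤L c+s<p 2+x≤p x∉run p→s c+s→x =
        [ (λ forward → subst (λ y → Arc D (r p) (r y)) h-end forward)
        , (λ back → ⊥-elim (geodesic-noChord geo (subst (λ y → 2 + y ≤ p) (sym h-end) 2+x≤p) p≤L back))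
        ]′ (geodesic-quasiTransitive h (λ {i} _ → ≤-trans (h≤p i) p≤L) injective along′)
        where
        run = runThen c s x
        h : ℕ → ℕ
        h zero = p
        h (suc i) = run i
        h-end : h k ≡ x
        h-end with runThen-cases c s x (suc c)
        ... | inj₁ (1+c≤c , _) = ⊥-elim (<-irrefl refl 1+c≤c)
        ... | inj₂ (_ , eq) = eq
        run<p : ∀ i → run i < p
        run<p i with runThen-cases c s x i
        ... | inj₁ (i≤c , eq) rewrite eq = ≤-<-trans (+-monoˡ-≤ s i≤c) c+s<p
        ... | inj₂ (_ , eq) rewrite eq = ≤-trans (n≤1+n _) 2+x≤p
        h≤p : ∀ i → h i ≤ p
        h≤p zero = ≤-refl
        h≤p (suc i) = <⇒≤ (run<p i)
        run≢x : ∀ {i} → i ≤ c → i + s ≢ x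
        run≢x {i} i≤c eq = [ (λ x<s → <⇒≱ x<s (subst (s ≤_) eq (m≤n+m s i)))
                           , (λ c+s<x → <⇒≱ c+s<x (subst (_≤ c + s) eq (+-monoˡ-≤ s i≤c))) ]′ x∉run
        injective : InjectiveUpTo h k
        injective {zero} {zero} _ _ _ = refl
        injective {zero} {suc j} _ _ eq = ⊥-elim (<⇒≢ (run<p j) (sym eq))
        injective {suc i} {zero} _ _ eq = ⊥-elim (<⇒≢ (run<p i) eq)
        injective {suc i} {suc j} i≤k j≤k eq with runThen-cases c s x i | runThen-cases c s x j
        ... | inj₁ (_ , eqi) | inj₁ (_ , eqj) = cong suc (+-cancelʳ-≡ s i j (trans (sym eqi) (trans eq eqj)))
        ... | inj₁ (i≤c , eqi) | inj₂ (_ , eqj) = ⊥-elim (run≢x i≤c (trans (sym eqi) (trans eq eqj)))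
        ... | inj₂ (_ , eqi) | inj₁ (j≤c , eqj) = ⊥-elim (run≢x j≤c (trans (sym eqj) (trans (sym eq) eqi)))
        ... | inj₂ (c<i , _) | inj₂ (c<j , _) =
          cong suc (trans (≤-antisym (s≤s⁻¹ i≤k) c<i) (≤-antisym c<j (s≤s⁻¹ j≤k)))
        along′ : WalkAlong (r ∘ h) k
        along′ {zero} _ with runThen-cases c s x 0
        ... | inj₁ (_ , eq) rewrite eq = p→s
        ... | inj₂ (() , _)
        along′ {suc i} i<k with runThen-cases c s x i | runThen-cases c s x (suc i)
        ... | inj₂ (c<i , _) | _ = ⊥-elim (<⇒≱ c<i (s≤s⁻¹ (s≤s⁻¹ i<k)))
        ... | inj₁ (_ , eqi) | inj₁ (1+i≤c , eq1+i) rewrite eqi | eq1+i =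
          along geo (<-≤-trans (+-monoˡ-< s 1+i≤c) (<⇒≤ (<-≤-trans c+s<p p≤L)))
        ... | inj₁ (_ , eqi) | inj₂ (c<1+i , eq1+i)
          rewrite eqi | eq1+i | ≤-antisym (s≤s⁻¹ (s≤s⁻¹ i<k)) (s≤s⁻¹ c<1+i) = c+s→x

      backArc-even : ∀ t a → 2 * t + (k + a) ≤ L → Arc D (r (2 * t + (k + a))) (r a)
      backArc-even zero a = backArc a
      backArc-even (suc t) a p≤L =
        detour p≤L c+s<p (≤-trans (s≤s (s≤s (m≤n+m a c))) (m≤n+m (k + a) (2 * suc t))) (inj₁ (m<n+m a z<s))
          (subst (λ y → Arc D (r y) (r s)) (sym p≡k+s) (backArc s (subst (_≤ L) p≡k+s p≤L)))
          (subst (λ y → Arc D (r y) (r a)) (sym (c+s≡ c t a))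
            (backArc-even t a (subst (_≤ L) (c+s≡ c t a) (≤-trans (<⇒≤ c+s<p) p≤L))))
        where
        s = 2 * suc t + a
        p≡k+s : 2 * suc t + (k + a) ≡ k + s
        p≡k+s = x∙yz≈y∙xz +-commutativeSemigroup (2 * suc t) k a
        c+s≡ : ∀ c t a → c + (2 * suc t + a) ≡ 2 * t + (2 + c + a)
        c+s≡ = solve-∀
        c+s<p : c + s < 2 * suc t + (k + a)
        c+s<p = subst (c + s <_) (sym p≡k+s) (m<n+m (c + s) {2} z<s)

      backArc-3 : ∀ b → suc c ≤ b → 3 + b ≤ L → Arc D (r (3 + b)) (r b)
      backArc-3 b 1+c≤b 3+b≤L with m≤n⇒∃[o]m+o≡n 1+c≤b
      ... | a , refl = detour 3+b≤L (m<n+m (c + a) {4} z<s) (n≤1+n _) (inj₂ ≤-refl)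
                         (backArc-even 1 a 3+b≤L) (along geo (≤-trans (m≤n+m (suc (c + a)) 3) 3+b≤L))

      geodesic-return : 2 + k ≤ L → Arc D (r L) (r 0) ⊎ (3 + k ≤ L × Walk (r L) (r 0) 2)
      geodesic-return 2+k≤L with m≤n⇒∃[o]m+o≡n 2+k≤L
      ... | d , refl with parity d
      ...   | t , inj₁ refl =
        inj₁ (subst (λ y → Arc D (r y) (r 0)) (sym (even c t))
               (backArc-even (suc t) 0 (≤-reflexive (sym (even c t)))))
        where
        even : ∀ c t → 2 + (2 + c) + 2 * t ≡ 2 * suc t + (2 + c + 0)
        even = solve-∀
      ...   | t , inj₂ refl =
        inj₂ (3+k≤L , subst (λ y → Walk (r y) (r 0) 2) (sym (odd c t)) (backArc-3 b 1+c≤b b+3≤L ◅ back ◅ ε))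
        where
        odd : ∀ c t → 2 + (2 + c) + (1 + 2 * t) ≡ 3 + (2 * t + (2 + c + 0))
        odd = solve-∀
        b = 2 * t + (k + 0)
        b+3≤L : 3 + b ≤ 2 + k + (1 + 2 * t)
        b+3≤L = ≤-reflexive (sym (odd c t))
        1+c≤b : suc c ≤ b
        1+c≤b = ≤-trans (s≤s (m≤n⇒m≤1+n (m≤m+n c 0))) (m≤n+m (k + 0) (2 * t))
        3+k≤L : 3 + k ≤ 2 + k + (1 + 2 * t)
        3+k≤L = subst (_≤ 2 + k + (1 + 2 * t)) (+-comm (2 + k) 1) (+-monoʳ-≤ (2 + k) (s≤s z≤n))
        back : Arc D (r b) (r 0)
        back = backArc-even t 0 (≤-trans (m≤n+m b 3) b+3≤L)

      geodesic-returnNear : 2 + k ≤ L → ∀ {j} → j < L → L ≤ 3 + j → Within (r L) (r j) 3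
      geodesic-returnNear 2+k≤L {j} j<L L≤3+j with m≤n⇒∃[o]m+o≡n 2+k≤L
      ... | d , refl with m≤n⇒∃[o]m+o≡n (+-cancelˡ-≤ 3 (suc c + d) j L≤3+j)
      ...   | f , refl = suc f , s≤s f≤2 , backArc-3 b (m≤m+n (suc c) d) ≤-refl ◅ segment
        where
        b = suc c + d
        f≤2 : f ≤ 2
        f≤2 = s≤s⁻¹ (+-cancelˡ-≤ b (suc f) 3 (subst₂ _≤_ (sym (+-suc b f)) (+-comm 3 b) j<L))
        segment : Walk (r b) (r (b + f)) f
        segment = subst (λ y → Walk (r b) (r y) f) (+-comm f b)
                    (walkAlong-segment b (along geo) (subst (_≤ 3 + b) (+-comm b f) (<⇒≤ j<L)))

    returnWalk : ∀ {u v L} → Shortest u v L → 2 + k ≤ L → Arc D v u ⊎ (3 + k ≤ L × Walk v u 2)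
    returnWalk s 2+k≤L with shortest-geodesic s
    ... | r , geo , refl , refl = geodesic-return geo 2+k≤L

    returnNear : ∀ {x y z m e} → Walk z x m → Walk x y e → 0 < e → e ≤ 3 →
                 (∀ {ℓ} → ℓ < m + e → ¬ Walk z y ℓ) → 2 + k ≤ m + e → Within y x 3
    returnNear {m = m} {e} zx xy 0<e e≤3 minimal 2+k≤m+e =
      subst₂ (λ a b → Within a b 3) (vertexAt-end (zx ◅◅ xy)) (vertexAt-◅◅ zx xy)
        (geodesic-returnNear (shortest⇒geodesic (zx ◅◅ xy) minimal) 2+k≤m+e (m<m+n m 0<e)
          (subst (m + e ≤_) (+-comm m 3) (+-monoʳ-≤ m e≤3)))

    -- If z were far from y, a shortest walk from z to y would have length at most k + 3: either
    -- z → x → y itself, and then y returns to x within 3 < N steps, or a walk of length k + 2,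
    -- whose return arc gives y → z → x of length at most k + 2 < N.
    within-transfer : ∀ {x y z N} → Shortest y x N → 2 + k ≤ N → Within z x (suc k) → Within z y (suc k)
    within-transfer {x} {y} {z} {N} yx 2+k≤N (m , m≤1+k , zx) with within? z y (suc k)
    ... | yes near = near
    ... | no far = ⊥-elim (impossible (returnWalk yx 2+k≤N))
      where
      tooClose : ∀ {l} → l < N → ¬ Within y x l
      tooClose = shortest⇒¬within yx
      viaReturn : ∀ {e} → Walk x y e → 0 < e → e ≤ 3 → (∀ {ℓ} → ℓ < m + e → ¬ Walk z y ℓ) → ⊥
      viaReturn xy 0<e e≤3 minimal =
        tooClose (≤-trans (s≤s (s≤s (s≤s (s≤s z≤n)))) 2+k≤N)
          (returnNear zx xy 0<e e≤3 minimal (¬within⇒long (zx ◅◅ xy) far))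
      m+1≤2+k : m + 1 ≤ 2 + k
      m+1≤2+k = subst (_≤ 2 + k) (+-comm 1 m) (s≤s m≤1+k)
      m+2≤3+k : m + 2 ≤ 3 + k
      m+2≤3+k = subst (_≤ 3 + k) (+-comm 2 m) (+-monoʳ-≤ 2 m≤1+k)
      impossible : Arc D x y ⊎ (3 + k ≤ N × Walk x y 2) → ⊥
      impossible (inj₁ x→y) =
        viaReturn (x→y ◅ ε) z<s (s≤s z≤n) (proj₂ (¬within⇒shortest (zx ◅◅ x→y ◅ ε) far m+1≤2+k))
      impossible (inj₂ (3+k≤N , xy)) with anyUpTo? (walk? z y) (m + 2)
      ... | no none = viaReturn xy z<s (s≤s (s≤s z≤n)) (λ ℓ<m+2 zy → none (_ , ℓ<m+2 , zy))
      ... | yes (ℓ , ℓ<m+2 , zy)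
        with returnWalk (¬within⇒shortest zy far (s≤s⁻¹ (≤-trans ℓ<m+2 m+2≤3+k))) (¬within⇒long zy far)
      ...   | inj₁ y→z = tooClose 3+k≤N (suc m , s≤s m≤1+k , y→z ◅ zx)
      ...   | inj₂ (3+k≤ℓ , _) = <-irrefl refl (≤-trans 3+k≤ℓ (s≤s⁻¹ (≤-trans ℓ<m+2 m+2≤3+k)))

    -- The kernel

    Terminal : Fin n → Set
    Terminal x = ∀ w → Reach x w → Reach w x

    Absorbing : Fin n → Set
    Absorbing x = ∀ y → Reach y x → Within y x (suc k)

    Candidate : Fin n → Set
    Candidate x = Terminal x × Absorbing x

    Selected : Fin n → Set
    Selected x = Candidate x × (∀ y → Candidate y → Reach x y → toℕ x ≤ toℕ y)

    candidate? : ∀ x → Dec (Candidate x)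
    candidate? x = all? (λ w → reach? x w →-dec reach? w x)
            ×-dec all? (λ y → reach? y x →-dec within? y x (suc k))

    selected? : ∀ x → Dec (Selected x)
    selected? x = candidate? x ×-dec all? (λ y → candidate? y →-dec reach? x y →-dec toℕ x ≤? toℕ y)

    reachesTerminal : ∀ u → ∃[ t ] (Reach u t × Terminal t)
    reachesTerminal u = descend reach-refl reach-trans (select ∘ reach?) step u tt
      where
      step : ∀ x → ⊤ → Terminal x ⊎ ∃[ y ] (Reach x y × ⊤ × select (reach? y) ⊂ select (reach? x))
      step x _ with any? (λ w → reach? x w ×-dec ¬? (reach? w x))
      ... | yes (w , x→w , w↛x) =
        inj₂ (w , x→w , tt , select-⊂ (reach? w) (reach? x) (reach-trans x→w) reach-refl w↛x)
      ... | no none = inj₁ λ w x→w → decidable-stable (reach? w x) (λ w↛x → none (w , x→w , w↛x))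

    reachesCandidate : ∀ t → Terminal t → ∃[ g ] (Reach t g × Candidate g)
    reachesCandidate = descend reach-refl reach-trans farFrom step
      where
      farFrom? : ∀ x z → Dec (¬ Within z x (suc k))
      farFrom? x z = ¬? (within? z x (suc k))
      farFrom : Fin n → Subset n
      farFrom x = select (farFrom? x)
      step : ∀ x → Terminal x → Candidate x ⊎ ∃[ y ] (Reach x y × Terminal y × farFrom y ⊂ farFrom x)
      step x terminal with any? (λ y → reach? y x ×-dec farFrom? x y)
      ... | no none =
        inj₁ (terminal , λ y y→x → decidable-stable (within? y x (suc k)) λ far → none (y , y→x , far))
      ... | yes (y , (_ , yx) , far) with shortest yx
      ...   | _ , _ , shortestYX = inj₂ (y , x→y , terminalY , farFromY⊂farFromX)
        where
        2+k≤N = ¬within⇒long (proj₁ shortestYX) far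
        x→y : Reach x y
        x→y = [ (λ e → 1 , e ◅ ε) , (λ (_ , w) → 2 , w) ]′ (returnWalk shortestYX 2+k≤N)
        terminalY : Terminal y
        terminalY w y→w = reach-trans (terminal w (reach-trans x→y y→w)) x→y
        farFromY⊂farFromX : farFrom y ⊂ farFrom x
        farFromY⊂farFromX = select-⊂ (farFrom? y) (farFrom? x)
          (λ farY nearX → farY (within-transfer shortestYX 2+k≤N nearX)) far (λ farY → farY (0 , z≤n , ε))

    reachesSelected : ∀ {x} → Candidate x → ∃[ s ] (Reach x s × Selected s)
    reachesSelected {x} candidate
      with leastWitness (λ m → any? λ y → (toℕ y ≟ m) ×-dec candidate? y ×-dec reach? x y)
                        (x , refl , candidate , reach-refl)
    ... | _ , (s , refl , candidateS , x→s) , least =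
      s , x→s , candidateS , λ y candidateY s→y →
        ≮⇒≥ λ y<s → least y<s (y , refl , candidateY , reach-trans x→s s→y)

    kernel-exists : ∃[ K ] IsKernel D (k + 2) K
    kernel-exists = select selected? , independent , absorbent
      where
      independent : Independent D (k + 2) (select selected?)
      independent u v u∈K v∈K u≢v ℓ _ path with ∈-select⁻ selected? u∈K | ∈-select⁻ selected? v∈K
      ... | candidateU , leastU | candidateV , leastV =
        u≢v (toℕ-injective (≤-antisym (leastU v candidateV u→v)
                                      (leastV u candidateU (proj₁ candidateU v u→v))))
        where
        u→v = ℓ , path⇒walk path
      absorbent : Absorbent D (k + 2 ∸ 1) (select selected?)
      absorbent u _ with reachesTerminal u
      ... | t , u→t , terminal with reachesCandidate t terminal
      ... | g , t→g , candidate with reachesSelected candidate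
      ... | s , g→s , selected with proj₂ (proj₁ selected) u (reach-trans u→t (reach-trans t→g g→s))
      ... | ℓ , ℓ≤1+k , us =
        s , ∈-select⁺ selected? selected
          , walk⇒distLe us (≤-trans ℓ≤1+k (≤-reflexive (cong suc (+-comm 2 c))))

mainTheorem10 : (k : ℕ) → 3 ≤ k → (∃[ j ] k ≡ 2 * j + 1) →
    (n : ℕ) (D : Digraph n) → QuasiTransitive k D →
    ∃[ K ] IsKernel D (k + 2) K
mainTheorem10 .(suc (suc c)) (s≤s (s≤s {n = c} _)) _ n D qt = kernel-exists D qt
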